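{- The function $F$ is strictly increasing on the positive integers, i.e. $F(N)<F(N+1)$ for every integer $N\ge 1$.
   Context: All graphs are finite and simple. For a graph $G$, $S(G)=\sum_{uv\in E(G)}\min(\deg u,\deg v)$. For an integer $N\ge 1$, $F(N)$ is the maximum of $S(G)$ over all graphs $G$ with exactly $N$ edges. -}

module Defs where

open import Data.Nat using (ℕ; _⊓_; _<ᵇ_; _≤_)
open import Data.Bool using (Bool; false; _∧_)
open import Data.Fin using (Fin; toℕ)
open import Data.Nat.ListAction using (sum)
open import Data.List using (List; length; map; concatMap; allFin; filterᵇ)
open import Data.Product using (_×_; _,_; Σ)
open import Relation.Binary.PropositionalEquality using (_≡_)

record Graph (n : ℕ) : Set where
  field
    adj    : Fin n → Fin n → Bool
    sym    : ∀ i j → adj i j ≡ adj j i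
    irrefl : ∀ i → adj i i ≡ false

open Graph public

deg : ∀ {n} → Graph n → Fin n → ℕ
deg {n} G v = length (filterᵇ (adj G v) (allFin n))

edges : ∀ {n} → Graph n → List (Fin n × Fin n)
edges {n} G =
  concatMap (λ i → map (λ j → (i , j))
                       (filterᵇ (λ j → (toℕ i <ᵇ toℕ j) ∧ adj G i j) (allFin n)))
            (allFin n)

numEdges : ∀ {n} → Graph n → ℕ
numEdges G = length (edges G)

S : ∀ {n} → Graph n → ℕ
S G = sum (map (λ e → deg G (Data.Product.proj₁ e) ⊓ deg G (Data.Product.proj₂ e)) (edges G))

-- "m = F(N)": m is the maximum of S(G) over all finite simple graphs G
-- (on any finite vertex set) with exactly N edges.
IsF : ℕ → ℕ → Set
IsF N m =
  Σ ℕ (λ n → Σ (Graph n) (λ G → numEdges G ≡ N × S G ≡ m))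
  × (∀ n (G : Graph n) → numEdges G ≡ N → S G ≤ m)

module Submission where

-- Adding a disjoint edge to a graph with N edges yields N + 1 edges and raises S by exactly 1
-- (the new edge contributes min(1, 1) and no old degree changes), so F(N + 1) ≥ F(N) + 1.
-- The real content is that the maximum F(N) exists. Deleting an isolated vertex changes neither
-- the edge count nor S, and by the handshake lemma a graph with N edges and no isolated vertex
-- has at most 2N vertices. Graphs on at most 2N vertices can be searched exhaustively, and on them
-- S ≤ N · 2N since every degree is bounded by the number of vertices; a bounded search from the
-- top then finds the largest attained value of S.

open import Defs
open import Data.Nat.Properties
  using (+-0-commutativeMonoid; +-identityʳ; +-mono-≤; *-monoʳ-≤; m≤m+n; m⊓n≤m; n≢0⇒n>0; ≤-trans; ≤∧≢⇒<; anyUpTo?; _≟_; module ≤-Reasoning)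
open import Algebra.Properties.CommutativeMonoid.Sum +-0-commutativeMonoid
  using (sum-syntax; sum-remove; ∑-distrib-+; ∑-comm; sum-cong-≗; sum-replicate-zero)
  renaming (sum to ∑)
open import Data.Bool using (Bool; true; false; T; T?; _∧_; if_then_else_)
open import Data.Bool.Properties using (∧-zeroʳ) renaming (_≟_ to _≟ᵇ_)
open import Data.Fin using (Fin; zero; suc; toℕ; punchIn)
open import Data.Fin.Properties using (any?; all?)
open import Data.List using (List; []; _∷_; _++_; length; map; concat; concatMap; allFin; filterᵇ; tabulate)
open import Data.List.Properties using (map-cong; map-++; map-∘; filter-≐; length-filter; length-tabulate)
open import Data.Nat using (ℕ; zero; suc; _+_; _*_; _≤_; _<_; _⊓_; _<ᵇ_; z≤n; s≤s; s≤s⁻¹)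
open import Data.Nat.ListAction using (sum)
open import Data.Nat.ListAction.Properties using (sum-++)
open import Data.Product using (Σ; ∃; _×_; _,_; proj₁; proj₂)
open import Data.Sum using (_⊎_; inj₁; inj₂)
open import Function using (_∘_; _∘₂_; const; id)
open import Data.Vec using (Vec; []; _∷_; lookup) renaming (tabulate to tabulateᵛ)
open import Data.Vec.Properties using (lookup∘tabulate)
open import Relation.Nullary using (Dec; yes; no)
open import Relation.Nullary.Decidable using (map′; _×-dec_; _⊎-dec_)
open import Relation.Unary using (Decidable)
open import Relation.Binary.PropositionalEquality
  using (_≡_; refl; trans; cong; cong₂; subst; module ≡-Reasoning)
  renaming (sym to ≡-sym)

mask : Bool → ℕ → ℕ
mask b x = if b then x else 0

sum-map-filterᵇ : ∀ {A : Set} (p : A → Bool) (g : A → ℕ) xs →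
  sum (map g (filterᵇ p xs)) ≡ sum (map (λ x → mask (p x) (g x)) xs)
sum-map-filterᵇ p g [] = refl
sum-map-filterᵇ p g (x ∷ xs) with p x
... | true  = cong (g x +_) (sum-map-filterᵇ p g xs)
... | false = sum-map-filterᵇ p g xs

sum-map-concatMap : ∀ {A B : Set} (h : A → List B) (g : B → ℕ) xs →
  sum (map g (concatMap h xs)) ≡ sum (map (λ x → sum (map g (h x))) xs)
sum-map-concatMap h g [] = refl
sum-map-concatMap h g (x ∷ xs) = begin
  sum (map g (h x ++ concatMap h xs))               ≡⟨ cong sum (map-++ g (h x) _) ⟩
  sum (map g (h x) ++ map g (concatMap h xs))       ≡⟨ sum-++ (map g (h x)) _ ⟩
  sum (map g (h x)) + sum (map g (concatMap h xs))  ≡⟨ cong (sum (map g (h x)) +_) (sum-map-concatMap h g xs) ⟩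
  sum (map (λ x → sum (map g (h x))) (x ∷ xs))      ∎
  where open ≡-Reasoning

sum-map-tabulate : ∀ {A : Set} n (f : Fin n → A) (g : A → ℕ) →
  sum (map g (tabulate f)) ≡ ∑[ i < n ] g (f i)
sum-map-tabulate zero    f g = refl
sum-map-tabulate (suc n) f g = cong (g (f zero) +_) (sum-map-tabulate n (f ∘ suc) g)

length≡sum-map-const-1 : ∀ {A : Set} (xs : List A) → length xs ≡ sum (map (const 1) xs)
length≡sum-map-const-1 []       = refl
length≡sum-map-const-1 (x ∷ xs) = cong suc (length≡sum-map-const-1 xs)

_≺_ : ∀ {n} → Fin n → Fin n → Bool
i ≺ j = toℕ i <ᵇ toℕ j

edgeSum : ∀ {n} → Graph n → (Fin n → Fin n → ℕ) → ℕ
edgeSum {n} G w = ∑[ i < n ] ∑[ j < n ] mask (i ≺ j ∧ adj G i j) (w i j)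

sum-map-edges : ∀ {n} (G : Graph n) (w : Fin n → Fin n → ℕ) →
  sum (map (λ e → w (proj₁ e) (proj₂ e)) (edges G)) ≡ edgeSum G w
sum-map-edges {n} G w = begin
  sum (map w′ (edges G))     ≡⟨ sum-map-concatMap neighbours w′ (allFin n) ⟩
  sum (map row (allFin n))   ≡⟨ sum-map-tabulate n id row ⟩
  ∑[ i < n ] row i           ≡⟨ sum-cong-≗ row-∑ ⟩
  edgeSum G w                ∎
  where
  open ≡-Reasoning
  w′ : Fin n × Fin n → ℕ
  w′ e = w (proj₁ e) (proj₂ e)
  later : Fin n → Fin n → Bool
  later i j = i ≺ j ∧ adj G i j
  neighbours : Fin n → List (Fin n × Fin n)
  neighbours i = map (i ,_) (filterᵇ (later i) (allFin n))
  row : Fin n → ℕ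
  row i = sum (map w′ (neighbours i))
  row-∑ : ∀ i → row i ≡ ∑[ j < n ] mask (later i j) (w i j)
  row-∑ i = begin
    sum (map w′ (neighbours i))                            ≡⟨ cong sum (map-∘ (filterᵇ (later i) (allFin n))) ⟨
    sum (map (w i) (filterᵇ (later i) (allFin n)))         ≡⟨ sum-map-filterᵇ (later i) (w i) (allFin n) ⟩
    sum (map (λ j → mask (later i j) (w i j)) (allFin n))  ≡⟨ sum-map-tabulate n id _ ⟩
    ∑[ j < n ] mask (later i j) (w i j)                    ∎

deg≡∑ : ∀ {n} (G : Graph n) v → deg G v ≡ ∑[ j < n ] mask (adj G v j) 1
deg≡∑ {n} G v = begin
  length (filterᵇ (adj G v) (allFin n))                ≡⟨ length≡sum-map-const-1 (filterᵇ (adj G v) (allFin n)) ⟩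
  sum (map (const 1) (filterᵇ (adj G v) (allFin n)))   ≡⟨ sum-map-filterᵇ (adj G v) (const 1) (allFin n) ⟩
  sum (map (λ j → mask (adj G v j) 1) (allFin n))      ≡⟨ sum-map-tabulate n id _ ⟩
  ∑[ j < n ] mask (adj G v j) 1                        ∎
  where open ≡-Reasoning

numEdges≡edgeSum : ∀ {n} (G : Graph n) → numEdges G ≡ edgeSum G (λ _ _ → 1)
numEdges≡edgeSum G = trans (length≡sum-map-const-1 (edges G)) (sum-map-edges G (λ _ _ → 1))

S≡edgeSum : ∀ {n} (G : Graph n) → S G ≡ edgeSum G (λ i j → deg G i ⊓ deg G j)
S≡edgeSum G = sum-map-edges G (λ i j → deg G i ⊓ deg G j)

SameAdj : ∀ {n} → Graph n → Graph n → Set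
SameAdj G H = ∀ i j → adj G i j ≡ adj H i j

filterᵇ-cong : ∀ {A : Set} {p q : A → Bool} → (∀ x → p x ≡ q x) → ∀ xs → filterᵇ p xs ≡ filterᵇ q xs
filterᵇ-cong {p = p} {q} p≗q =
  filter-≐ (T? ∘ p) (T? ∘ q) ((λ {x} → subst T (p≗q x)) , (λ {x} → subst T (≡-sym (p≗q x))))

module _ {n} {G H : Graph n} (G≈H : SameAdj G H) where

  deg-cong : ∀ v → deg G v ≡ deg H v
  deg-cong v = cong length (filterᵇ-cong (G≈H v) (allFin n))

  edges-cong : edges G ≡ edges H
  edges-cong = cong concat (map-cong (λ i → cong (map (i ,_))
    (filterᵇ-cong (λ j → cong (i ≺ j ∧_) (G≈H i j)) (allFin n))) (allFin n))

  numEdges-cong : numEdges G ≡ numEdges H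
  numEdges-cong = cong length edges-cong

  S-cong : S G ≡ S H
  S-cong = cong sum (trans
    (map-cong (λ e → cong₂ _⊓_ (deg-cong (proj₁ e)) (deg-cong (proj₂ e))) (edges G))
    (cong (map _) edges-cong))

data Order {n} (i j : Fin n) : Set where
  less    : i ≺ j ≡ true  → j ≺ i ≡ false → Order i j
  equal   : i ≡ j → Order i j
  greater : i ≺ j ≡ false → j ≺ i ≡ true  → Order i j

order : ∀ {n} (i j : Fin n) → Order i j
order zero    zero    = equal refl
order zero    (suc j) = less refl refl
order (suc i) zero    = greater refl refl
order (suc i) (suc j) with order i j
... | less p q    = less p q
... | equal refl  = equal refl
... | greater p q = greater p q

≺-punchIn : ∀ {n} (v : Fin (suc n)) (i j : Fin n) → punchIn v i ≺ punchIn v j ≡ i ≺ j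
≺-punchIn zero    i       j       = refl
≺-punchIn (suc v) zero    zero    = refl
≺-punchIn (suc v) zero    (suc j) = refl
≺-punchIn (suc v) (suc i) zero    = refl
≺-punchIn (suc v) (suc i) (suc j) = ≺-punchIn v i j

term≤∑ : ∀ {n} (f : Fin n → ℕ) v → f v ≤ ∑[ i < n ] f i
term≤∑ {suc n} f v = subst (f v ≤_) (≡-sym (sum-remove {i = v} f)) (m≤m+n (f v) _)

n≤∑-positive : ∀ {n} (f : Fin n → ℕ) → (∀ i → 0 < f i) → n ≤ ∑[ i < n ] f i
n≤∑-positive {zero}  f f>0 = z≤n
n≤∑-positive {suc n} f f>0 = +-mono-≤ (f>0 zero) (n≤∑-positive (f ∘ suc) (f>0 ∘ suc))

∑-removeZero : ∀ {n} (t : Fin (suc n) → ℕ) v → t v ≡ 0 → ∑[ i < suc n ] t i ≡ ∑[ i < n ] t (punchIn v i)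
∑-removeZero {n} t v tv≡0 = trans (sum-remove {i = v} t) (cong (_+ ∑[ i < n ] t (punchIn v i)) tv≡0)

mask-adj-split : ∀ {n} (G : Graph n) i j →
  mask (adj G i j) 1 ≡ mask (i ≺ j ∧ adj G i j) 1 + mask (j ≺ i ∧ adj G j i) 1
mask-adj-split G i j with order i j
... | less p q    rewrite p | q = ≡-sym (+-identityʳ _)
... | greater p q rewrite p | q | sym G j i = refl
... | equal refl  rewrite irrefl G i | ∧-zeroʳ (i ≺ i) = refl

handshake : ∀ {n} (G : Graph n) → ∑[ v < n ] deg G v ≡ numEdges G + numEdges G
handshake {n} G = begin
  ∑[ i < n ] deg G i                                   ≡⟨ sum-cong-≗ (deg≡∑ G) ⟩
  ∑[ i < n ] ∑[ j < n ] mask (adj G i j) 1              ≡⟨ sum-cong-≗ (λ i → sum-cong-≗ (mask-adj-split G i)) ⟩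
  ∑[ i < n ] ∑[ j < n ] (e i j + e j i)                 ≡⟨ sum-cong-≗ (λ i → ∑-distrib-+ (e i) (λ j → e j i)) ⟩
  ∑[ i < n ] (∑[ j < n ] e i j + ∑[ j < n ] e j i)      ≡⟨ ∑-distrib-+ (λ i → ∑[ j < n ] e i j) (λ i → ∑[ j < n ] e j i) ⟩
  edgeSum G one + ∑[ i < n ] ∑[ j < n ] e j i           ≡⟨ cong (edgeSum G one +_) (∑-comm (λ i j → e j i)) ⟩
  edgeSum G one + edgeSum G one                         ≡⟨ cong₂ _+_ (numEdges≡edgeSum G) (numEdges≡edgeSum G) ⟨
  numEdges G + numEdges G                               ∎
  where
  open ≡-Reasoning
  one : Fin n → Fin n → ℕ
  one _ _ = 1
  e : Fin n → Fin n → ℕ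
  e i j = mask (i ≺ j ∧ adj G i j) 1

Isolated : ∀ {n} → Graph n → Fin n → Set
Isolated G v = ∀ j → adj G v j ≡ false

deg≡0⇒isolated : ∀ {n} (G : Graph n) v → deg G v ≡ 0 → Isolated G v
deg≡0⇒isolated G v deg≡0 j =
  mask-1≤0 (subst (mask (adj G v j) 1 ≤_) (trans (≡-sym (deg≡∑ G v)) deg≡0) (term≤∑ _ j))
  where
  mask-1≤0 : ∀ {b} → mask b 1 ≤ 0 → b ≡ false
  mask-1≤0 {false} _ = refl

removeVertex : ∀ {n} → Graph (suc n) → Fin (suc n) → Graph n
removeVertex G v = record
  { adj    = λ i j → adj G (punchIn v i) (punchIn v j)
  ; sym    = λ i j → sym G (punchIn v i) (punchIn v j)
  ; irrefl = λ i → irrefl G (punchIn v i)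
  }

module _ {n} (G : Graph (suc n)) (v : Fin (suc n)) (v-isolated : Isolated G v) where

  private
    G-v : Graph n
    G-v = removeVertex G v

    mask-to-v : ∀ u b x → mask (b ∧ adj G u v) x ≡ 0
    mask-to-v u b x rewrite sym G u v | v-isolated u | ∧-zeroʳ b = refl

  deg-removeVertex : ∀ i → deg G-v i ≡ deg G (punchIn v i)
  deg-removeVertex i = begin
    deg G-v i
      ≡⟨ deg≡∑ G-v i ⟩
    ∑[ j < n ] mask (adj G (punchIn v i) (punchIn v j)) 1
      ≡⟨ ∑-removeZero (λ j → mask (adj G (punchIn v i) j) 1) v (mask-to-v (punchIn v i) true 1) ⟨
    ∑[ j < suc n ] mask (adj G (punchIn v i) j) 1
      ≡⟨ deg≡∑ G (punchIn v i) ⟨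
    deg G (punchIn v i)
      ∎
    where open ≡-Reasoning

  edgeSum-removeVertex : ∀ w → edgeSum G w ≡ edgeSum G-v (λ i j → w (punchIn v i) (punchIn v j))
  edgeSum-removeVertex w = begin
    ∑[ i < suc n ] ∑[ j < suc n ] t i j
      ≡⟨ ∑-removeZero (λ i → ∑[ j < suc n ] t i j) v (trans (sum-cong-≗ t-from-v) (sum-replicate-zero (suc n))) ⟩
    ∑[ i < n ] ∑[ j < suc n ] t (punchIn v i) j
      ≡⟨ sum-cong-≗ (λ i → ∑-removeZero (t (punchIn v i)) v (t-to-v (punchIn v i))) ⟩
    ∑[ i < n ] ∑[ j < n ] t (punchIn v i) (punchIn v j)
      ≡⟨ sum-cong-≗ (λ i → sum-cong-≗ (λ j →
           cong (λ b → mask (b ∧ adj G-v i j) (w (punchIn v i) (punchIn v j))) (≺-punchIn v i j))) ⟩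
    edgeSum G-v (λ i j → w (punchIn v i) (punchIn v j))
      ∎
    where
    open ≡-Reasoning
    t : Fin (suc n) → Fin (suc n) → ℕ
    t i j = mask (i ≺ j ∧ adj G i j) (w i j)
    t-from-v : ∀ j → t v j ≡ 0
    t-from-v j rewrite v-isolated j | ∧-zeroʳ (v ≺ j) = refl
    t-to-v : ∀ u → t u v ≡ 0
    t-to-v u = mask-to-v u (u ≺ v) (w u v)

  numEdges-removeVertex : numEdges G-v ≡ numEdges G
  numEdges-removeVertex = begin
    numEdges G-v                ≡⟨ numEdges≡edgeSum G-v ⟩
    edgeSum G-v (λ _ _ → 1)     ≡⟨ edgeSum-removeVertex (λ _ _ → 1) ⟨
    edgeSum G (λ _ _ → 1)       ≡⟨ numEdges≡edgeSum G ⟨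
    numEdges G                  ∎
    where open ≡-Reasoning

  S-removeVertex : S G-v ≡ S G
  S-removeVertex = begin
    S G-v
      ≡⟨ S≡edgeSum G-v ⟩
    edgeSum G-v (λ i j → deg G-v i ⊓ deg G-v j)
      ≡⟨ sum-cong-≗ (λ i → sum-cong-≗ (λ j →
           cong (mask _) (cong₂ _⊓_ (deg-removeVertex i) (deg-removeVertex j)))) ⟩
    edgeSum G-v (λ i j → deg G (punchIn v i) ⊓ deg G (punchIn v j))
      ≡⟨ edgeSum-removeVertex (λ i j → deg G i ⊓ deg G j) ⟨
    edgeSum G (λ i j → deg G i ⊓ deg G j)
      ≡⟨ S≡edgeSum G ⟨
    S G
      ∎
    where open ≡-Reasoning

AttainsOn : ℕ → ℕ → ℕ → Set
AttainsOn n N s = Σ (Graph n) λ G → numEdges G ≡ N × S G ≡ s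

shrinkToFewVertices : ∀ n {N s} → AttainsOn n N s → ∃ λ m → m ≤ N + N × AttainsOn m N s
shrinkToFewVertices zero    G-attains = zero , z≤n , G-attains
shrinkToFewVertices (suc n) (G , G-edges , G-S) with any? (λ v → deg G v ≟ 0)
... | yes (v , deg≡0) =
  let iso = deg≡0⇒isolated G v deg≡0 in
  shrinkToFewVertices n (removeVertex G v ,
    trans (numEdges-removeVertex G v iso) G-edges , trans (S-removeVertex G v iso) G-S)
... | no no-isolated =
  suc n , subst (suc n ≤_) (trans (handshake G) (cong₂ _+_ G-edges G-edges))
            (n≤∑-positive (deg G) (λ v → n≢0⇒n>0 (λ deg≡0 → no-isolated (v , deg≡0)))) ,
  G , G-edges , G-S

deg≤n : ∀ {n} (G : Graph n) v → deg G v ≤ n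
deg≤n {n} G v = subst (deg G v ≤_) (length-tabulate id) (length-filter (T? ∘ adj G v) (allFin n))

sum-map-≤ : ∀ {A : Set} (f : A → ℕ) {c} → (∀ x → f x ≤ c) → ∀ xs → sum (map f xs) ≤ length xs * c
sum-map-≤ f f≤c []       = z≤n
sum-map-≤ f f≤c (x ∷ xs) = +-mono-≤ (f≤c x) (sum-map-≤ f f≤c xs)

S≤numEdges*n : ∀ {n} (G : Graph n) → S G ≤ numEdges G * n
S≤numEdges*n G = sum-map-≤ _ (λ e → ≤-trans (m⊓n≤m _ _) (deg≤n G (proj₁ e))) (edges G)

Attains : ℕ → ℕ → Set
Attains N s = ∃ λ n → AttainsOn n N s

Attains-bounded : ∀ {N s} → Attains N s → s ≤ N * (N + N)
Attains-bounded {N} {s} (n , G-attains) with shrinkToFewVertices n G-attains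
... | m , m≤N+N , H , H-edges , H-S = begin
  s               ≡⟨ H-S ⟨
  S H             ≤⟨ S≤numEdges*n H ⟩
  numEdges H * m  ≡⟨ cong (_* m) H-edges ⟩
  N * m           ≤⟨ *-monoʳ-≤ N m≤N+N ⟩
  N * (N + N)     ∎
  where open ≤-Reasoning

Searchable : Set → Set₁
Searchable A = ∀ {P : A → Set} → Decidable P → Dec (∃ P)

searchable-Bool : Searchable Bool
searchable-Bool {P} P? = map′ from to (P? true ⊎-dec P? false)
  where
  from : P true ⊎ P false → ∃ P
  to   : ∃ P → P true ⊎ P false
  from = λ { (inj₁ p) → true , p ; (inj₂ p) → false , p }
  to   = λ { (true , p) → inj₁ p ; (false , p) → inj₂ p }

searchable-Vec : ∀ {A} → Searchable A → ∀ k → Searchable (Vec A k)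
searchable-Vec search-A zero    P? = map′ ([] ,_) (λ { ([] , p) → p }) (P? [])
searchable-Vec search-A (suc k) P? =
  map′ (λ (a , v , p) → a ∷ v , p) (λ { (a ∷ v , p) → a , v , p })
       (search-A (λ a → searchable-Vec search-A k (P? ∘ (a ∷_))))

module _ {m} (M : Vec (Vec Bool m) m) where

  entry : Fin m → Fin m → Bool
  entry i j = lookup (lookup M i) j

  IsSymmetric IsIrreflexive : Set
  IsSymmetric   = ∀ i j → entry i j ≡ entry j i
  IsIrreflexive = ∀ i → entry i i ≡ false

  isSymmetric? : Dec IsSymmetric
  isSymmetric? = all? (λ i → all? (λ j → entry i j ≟ᵇ entry j i))

  isIrreflexive? : Dec IsIrreflexive
  isIrreflexive? = all? (λ i → entry i i ≟ᵇ false)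

  fromMatrix : IsSymmetric → IsIrreflexive → Graph m
  fromMatrix symmetric irreflexive = record { adj = entry ; sym = symmetric ; irrefl = irreflexive }

toMatrix : ∀ {m} → Graph m → Vec (Vec Bool m) m
toMatrix G = tabulateᵛ (λ i → tabulateᵛ (adj G i))

entry-toMatrix : ∀ {m} (G : Graph m) i j → entry (toMatrix G) i j ≡ adj G i j
entry-toMatrix G i j = trans (cong (λ row → lookup row j) (lookup∘tabulate _ i)) (lookup∘tabulate (adj G i) j)

-- The search runs over adjacency matrices, hence the invariance of P under SameAdj.
searchable-Graph : ∀ m {P : Graph m → Set} → (∀ {G H} → SameAdj G H → P G → P H) →
  Decidable P → Dec (∃ P)
searchable-Graph m {P} P-resp P? =
  map′ (λ (M , (symmetric , irreflexive) , p) → fromMatrix M symmetric irreflexive , p)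
       (λ (G , p) → toMatrix G , (symmetric G , irreflexive G) , P-resp (≡-sym ∘₂ entry-toMatrix G) p)
       (searchable-Vec (searchable-Vec searchable-Bool m) m Q?)
  where
  Q : Vec (Vec Bool m) m → Set
  Q M = Σ (IsSymmetric M × IsIrreflexive M) λ (symmetric , irreflexive) → P (fromMatrix M symmetric irreflexive)
  Q? : Decidable Q
  Q? M with isSymmetric? M | isIrreflexive? M
  ... | yes symmetric | yes irreflexive =
    map′ ((symmetric , irreflexive) ,_) (λ (_ , p) → P-resp (λ _ _ → refl) p) (P? (fromMatrix M symmetric irreflexive))
  ... | no ¬symmetric | _              = no (¬symmetric ∘ proj₁ ∘ proj₁)
  ... | _             | no ¬irreflexive = no (¬irreflexive ∘ proj₂ ∘ proj₁)
  symmetric : ∀ G → IsSymmetric (toMatrix G)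
  symmetric G i j rewrite entry-toMatrix G i j | entry-toMatrix G j i = sym G i j
  irreflexive : ∀ G → IsIrreflexive (toMatrix G)
  irreflexive G i rewrite entry-toMatrix G i i = irrefl G i

attainsOn? : ∀ n N s → Dec (AttainsOn n N s)
attainsOn? n N s = searchable-Graph n
  (λ {G} {H} G≈H (G-edges , G-S) →
     trans (≡-sym (numEdges-cong {G = G} {H} G≈H)) G-edges , trans (≡-sym (S-cong {G = G} {H} G≈H)) G-S)
  (λ G → numEdges G ≟ N ×-dec S G ≟ s)

attains? : ∀ N s → Dec (Attains N s)
attains? N s = map′ (λ (m , _ , G-attains) → m , G-attains) few-vertices
                    (anyUpTo? (λ m → attainsOn? m N s) (suc (N + N)))
  where
  few-vertices : Attains N s → ∃ λ m → m < suc (N + N) × AttainsOn m N s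
  few-vertices (n , G-attains) with shrinkToFewVertices n G-attains
  ... | m , m≤N+N , H-attains = m , s≤s m≤N+N , H-attains

greatest : ∀ {P : ℕ → Set} → Decidable P → ∀ B → (∀ {s} → P s → s ≤ B) →
  ∀ {k} → P k → ∃ λ s → P s × (∀ {t} → P t → t ≤ s)
greatest P? zero    ≤B {k} Pk = k , Pk , λ Pt → ≤-trans (≤B Pt) z≤n
greatest P? (suc B) ≤B     Pk with P? (suc B)
... | yes PB = suc B , PB , ≤B
... | no ¬PB = greatest P? B (λ Pt → s≤s⁻¹ (≤∧≢⇒< (≤B Pt) λ { refl → ¬PB Pt })) Pk

module _ {n} (G : Graph n) where

  private
    adj⁺ : Fin (suc (suc n)) → Fin (suc (suc n)) → Bool
    adj⁺ zero          (suc zero)    = true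
    adj⁺ (suc zero)    zero          = true
    adj⁺ (suc (suc i)) (suc (suc j)) = adj G i j
    adj⁺ _             _             = false

    adj⁺-sym : ∀ i j → adj⁺ i j ≡ adj⁺ j i
    adj⁺-sym zero          zero          = refl
    adj⁺-sym zero          (suc zero)    = refl
    adj⁺-sym zero          (suc (suc j)) = refl
    adj⁺-sym (suc zero)    zero          = refl
    adj⁺-sym (suc zero)    (suc zero)    = refl
    adj⁺-sym (suc zero)    (suc (suc j)) = refl
    adj⁺-sym (suc (suc i)) zero          = refl
    adj⁺-sym (suc (suc i)) (suc zero)    = refl
    adj⁺-sym (suc (suc i)) (suc (suc j)) = sym G i j

    adj⁺-irrefl : ∀ i → adj⁺ i i ≡ false
    adj⁺-irrefl zero          = refl
    adj⁺-irrefl (suc zero)    = refl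
    adj⁺-irrefl (suc (suc i)) = irrefl G i

  addDisjointEdge : Graph (suc (suc n))
  addDisjointEdge = record { adj = adj⁺ ; sym = adj⁺-sym ; irrefl = adj⁺-irrefl }

  private
    G⁺ : Graph (suc (suc n))
    G⁺ = addDisjointEdge

    ∑-0 : ∑[ i < n ] 0 ≡ 0
    ∑-0 = sum-replicate-zero n

  deg-addDisjointEdge-new₀ : deg G⁺ zero ≡ 1
  deg-addDisjointEdge-new₀ = trans (deg≡∑ G⁺ zero) (cong suc ∑-0)

  deg-addDisjointEdge-new₁ : deg G⁺ (suc zero) ≡ 1
  deg-addDisjointEdge-new₁ = trans (deg≡∑ G⁺ (suc zero)) (cong suc ∑-0)

  deg-addDisjointEdge-old : ∀ i → deg G⁺ (suc (suc i)) ≡ deg G i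
  deg-addDisjointEdge-old i = trans (deg≡∑ G⁺ (suc (suc i))) (≡-sym (deg≡∑ G i))

  edgeSum-addDisjointEdge : ∀ w →
    edgeSum G⁺ w ≡ w zero (suc zero) + edgeSum G (λ i j → w (suc (suc i)) (suc (suc j)))
  edgeSum-addDisjointEdge w =
    cong₂ _+_ (trans (cong (w zero (suc zero) +_) ∑-0) (+-identityʳ _))
              (cong (_+ edgeSum G (λ i j → w (suc (suc i)) (suc (suc j)))) ∑-0)

  numEdges-addDisjointEdge : numEdges G⁺ ≡ suc (numEdges G)
  numEdges-addDisjointEdge = begin
    numEdges G⁺                  ≡⟨ numEdges≡edgeSum G⁺ ⟩
    edgeSum G⁺ (λ _ _ → 1)       ≡⟨ edgeSum-addDisjointEdge (λ _ _ → 1) ⟩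
    suc (edgeSum G (λ _ _ → 1))  ≡⟨ cong suc (numEdges≡edgeSum G) ⟨
    suc (numEdges G)             ∎
    where open ≡-Reasoning

  S-addDisjointEdge : S G⁺ ≡ suc (S G)
  S-addDisjointEdge = begin
    S G⁺
      ≡⟨ S≡edgeSum G⁺ ⟩
    edgeSum G⁺ (λ i j → deg G⁺ i ⊓ deg G⁺ j)
      ≡⟨ edgeSum-addDisjointEdge (λ i j → deg G⁺ i ⊓ deg G⁺ j) ⟩
    deg G⁺ zero ⊓ deg G⁺ (suc zero) + edgeSum G (λ i j → deg G⁺ (suc (suc i)) ⊓ deg G⁺ (suc (suc j)))
      ≡⟨ cong₂ _+_ (cong₂ _⊓_ deg-addDisjointEdge-new₀ deg-addDisjointEdge-new₁)
                   (sum-cong-≗ (λ i → sum-cong-≗ (λ j →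
                      cong (mask _) (cong₂ _⊓_ (deg-addDisjointEdge-old i) (deg-addDisjointEdge-old j))))) ⟩
    suc (edgeSum G (λ i j → deg G i ⊓ deg G j))
      ≡⟨ cong suc (S≡edgeSum G) ⟨
    suc (S G)
      ∎
    where open ≡-Reasoning

emptyGraph : Graph 0
emptyGraph = record { adj = λ () ; sym = λ () ; irrefl = λ () }

Attains-some : ∀ N → ∃ (Attains N)
Attains-some zero    = 0 , 0 , emptyGraph , refl , refl
Attains-some (suc N) with Attains-some N
... | s , n , G , G-edges , G-S = suc s , suc (suc n) , addDisjointEdge G ,
  trans (numEdges-addDisjointEdge G) (cong suc G-edges) , trans (S-addDisjointEdge G) (cong suc G-S)

F-exists : ∀ N → ∃ (IsF N)
F-exists N with Attains-some N
... | s , N-attains-s with greatest (attains? N) (N * (N + N)) Attains-bounded N-attains-s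
... | F , N-attains-F , F-max = F , N-attains-F , λ n G G-edges → F-max (n , G , G-edges , refl)

IsF-<-suc : ∀ {N a b} → IsF N a → IsF (suc N) b → a < b
IsF-<-suc {b = b} ((n , G , G-edges , G-S) , _) (_ , b-max) =
  subst (_≤ b) (trans (S-addDisjointEdge G) (cong suc G-S))
        (b-max _ (addDisjointEdge G) (trans (numEdges-addDisjointEdge G) (cong suc G-edges)))

lemma2 : (N : ℕ) → 1 ≤ N →
    Σ ℕ (λ a → Σ ℕ (λ b → IsF N a × IsF (suc N) b × a < b))
lemma2 N _ with F-exists N | F-exists (suc N)
... | a , F[N]≡a | b , F[N+1]≡b = a , b , F[N]≡a , F[N+1]≡b , IsF-<-suc F[N]≡a F[N+1]≡b
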